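{- Let $E$ be an $n\times n$ Erdős matrix. Then $\operatorname{tr}_{\sigma_0}(E)=\operatorname{maxtrace}(E)$ for every $\sigma_0\in P_n(E)$.
   Context: A real $n\times n$ matrix is bistochastic if all entries lie in $[0,1]$ and every row and column sum equals $1$. $P_n$ is the set of $n\times n$ permutation matrices; for $\sigma\in P_n$, $\operatorname{tr}_\sigma(M)=\operatorname{tr}(\sigma^TM)$ and $\operatorname{maxtrace}(M)=\max_{\sigma\in P_n}\operatorname{tr}_\sigma(M)$. A bistochastic $E$ is Erdős if $\operatorname{maxtrace}(E)=\sum_{i,j}E_{i,j}^2$. $P_n(E)$ is the set of $\sigma\in P_n$ such that $E_{i,j}\neq 0$ whenever $\sigma_{i,j}=1$. -}

module Defs where

open import Level using (Level; _⊔_) renaming (suc to lsuc)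
open import Data.Nat using (ℕ)
open import Data.Fin using (Fin; zero; suc; _≟_)
open import Data.Fin.Permutation using (Permutation′; _⟨$⟩ʳ_)
open import Data.Product using (Σ; _×_; ∃)
open import Data.Sum using (_⊎_)
open import Relation.Nullary using (¬_; yes; no)
open import Relation.Binary.PropositionalEquality using (_≡_)

-- A (discrete, propositional-equality) ordered field.  The real numbers are a
-- model; stdlib has no reals, so the statement is made for every ordered field.
record OrderedField (c ℓ : Level) : Set (lsuc (c ⊔ ℓ)) where
  infixl 6 _+_
  infixl 7 _*_
  infix  4 _≤_
  field
    Carrier : Set c
    0# 1#   : Carrier
    _+_ _*_ : Carrier → Carrier → Carrier
    -_      : Carrier → Carrier
    _≤_     : Carrier → Carrier → Set ℓ
    +-assoc  : ∀ x y z → (x + y) + z ≡ x + (y + z)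
    +-comm   : ∀ x y → x + y ≡ y + x
    +-identityˡ : ∀ x → 0# + x ≡ x
    -‿inverseˡ  : ∀ x → (- x) + x ≡ 0#
    *-assoc  : ∀ x y z → (x * y) * z ≡ x * (y * z)
    *-comm   : ∀ x y → x * y ≡ y * x
    *-identityˡ : ∀ x → 1# * x ≡ x
    distribˡ : ∀ x y z → x * (y + z) ≡ (x * y) + (x * z)
    0≢1      : ¬ (0# ≡ 1#)
    inverse  : ∀ x → ¬ (x ≡ 0#) → Σ Carrier (λ y → x * y ≡ 1#)
    ≤-refl    : ∀ x → x ≤ x
    ≤-trans   : ∀ {x y z} → x ≤ y → y ≤ z → x ≤ z
    ≤-antisym : ∀ {x y} → x ≤ y → y ≤ x → x ≡ y
    ≤-total   : ∀ x y → (x ≤ y) ⊎ (y ≤ x)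
    +-mono-≤  : ∀ {x y} z → x ≤ y → x + z ≤ y + z
    *-nonneg  : ∀ {x y} → 0# ≤ x → 0# ≤ y → 0# ≤ x * y

module Matrices {c ℓ} (F : OrderedField c ℓ) where
  open OrderedField F

  Matrix : ℕ → Set c
  Matrix n = Fin n → Fin n → Carrier

  ∑ : ∀ {n} → (Fin n → Carrier) → Carrier
  ∑ {ℕ.zero}  f = 0#
  ∑ {ℕ.suc n} f = f zero + ∑ (λ i → f (suc i))

  transpose : ∀ {n} → Matrix n → Matrix n
  transpose M i j = M j i

  _⊗_ : ∀ {n} → Matrix n → Matrix n → Matrix n
  (A ⊗ B) i j = ∑ (λ k → A i k * B k j)

  tr : ∀ {n} → Matrix n → Carrier
  tr M = ∑ (λ i → M i i)

  Bistochastic : ∀ {n} → Matrix n → Set (c ⊔ ℓ)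
  Bistochastic {n} M =
    (∀ i j → (0# ≤ M i j) × (M i j ≤ 1#)) ×
    (∀ i → ∑ (λ j → M i j) ≡ 1#) ×
    (∀ j → ∑ (λ i → M i j) ≡ 1#)

  -- P_n: permutation matrices, indexed by permutations π of Fin n;
  -- the matrix of π has entry 1 at (i, π i) and 0 elsewhere.
  permMatrix : ∀ {n} → Permutation′ n → Matrix n
  permMatrix π i j with (π ⟨$⟩ʳ i) ≟ j
  ... | yes _ = 1#
  ... | no  _ = 0#

  trσ : ∀ {n} → Permutation′ n → Matrix n → Carrier
  trσ σ M = tr (transpose (permMatrix σ) ⊗ M)

  IsMaxtrace : ∀ {n} → Carrier → Matrix n → Set (c ⊔ ℓ)
  IsMaxtrace {n} m M =
    (∃ λ (σ : Permutation′ n) → trσ σ M ≡ m) × (∀ σ → trσ σ M ≤ m)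

  sumSq : ∀ {n} → Matrix n → Carrier
  sumSq E = ∑ (λ i → ∑ (λ j → E i j * E i j))

  Erdős : ∀ {n} → Matrix n → Set (c ⊔ ℓ)
  Erdős E = Bistochastic E × IsMaxtrace (sumSq E) E

  _∈P[_] : ∀ {n} → Permutation′ n → Matrix n → Set c
  σ ∈P[ E ] = ∀ i j → permMatrix σ i j ≡ 1# → ¬ (E i j ≡ 0#)

-- Let ε > 0 be the least entry of E on the support of σ₀.  Then X = E − ε·σ₀ is nonnegative
-- with all line sums 1 − ε, and the Birkhoff-type bound ⟨X, E⟩ ≤ t · maxtrace(E), valid for
-- every nonnegative X whose row and column sums all equal t, yields
--   ⟨E, E⟩ − ε · tr_σ₀(E) ≤ (1 − ε) · maxtrace(E).
-- For an Erdős matrix ⟨E, E⟩ = maxtrace(E), so maxtrace(E) ≤ tr_σ₀(E).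
--
-- The bound is proved by cycle cancelling rather than by a Birkhoff–von Neumann decomposition.
-- Since equality in an ordered field is undecidable, we record which entries are known to vanish
-- and call the others open; each step records one more vanishing entry without decreasing ⟨X, E⟩.
-- The only open entry of a row equals t, so the other entries of its column vanish.  Once none of
-- these remain unrecorded, a row with two open entries starts an alternating walk through open
-- entries that never gets stuck; it closes into a cycle, and shifting mass around the cycle in the
-- direction that does not decrease ⟨X, E⟩ makes one more open entry vanish.  If no row has two
-- open entries, X is t times a permutation matrix σ, so ⟨X, E⟩ = t · tr_σ(E) ≤ t · maxtrace(E).

{-# OPTIONS --safe #-}
module Submission where

open import Defs
open import Level using (Level; _⊔_)
open import Algebra.Bundles using (CommutativeRing)
open import Algebra.Consequences.Propositional
  using (comm∧idˡ⇒id; comm∧invˡ⇒inv; comm∧distrˡ⇒distrʳ)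
import Algebra.Properties.Ring as RingProperties
import Algebra.Properties.CommutativeSemigroup as CommutativeSemigroupProperties
open import Data.Bool using (Bool; true; false; _∨_; _∧_; if_then_else_)
open import Data.Bool.Properties using (¬-not)
open import Data.Empty using (⊥-elim)
open import Data.Fin as Fin using (Fin; zero; suc; _≟_; toℕ)
open import Data.Fin.Permutation
  using (Permutation′; permutation; _⟨$⟩ʳ_; _⟨$⟩ˡ_; inverseˡ; inverseʳ)
open import Data.Fin.Properties
  using (suc-injective; any?; pigeonhole; toℕ<n; toℕ-fromℕ<; toℕ-injective)
open import Data.Nat as ℕ using (ℕ; zero; suc; z<s; s<s)
import Data.Nat.Properties as ℕ
open import Data.Nat.Induction using (<-wellFounded)
open import Data.Product using (Σ; ∃; ∃₂; _×_; _,_; proj₁; proj₂; uncurry; swap)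
open import Data.Product.Properties using (≡-dec)
open import Data.Sum using (_⊎_; inj₁; inj₂; [_,_])
open import Function using (case_of_; flip)
open import Function.Definitions using (Injective)
open import Induction.WellFounded using (module All)
import Relation.Binary.Construct.On as On
open import Relation.Binary.Definitions using (DecidableEquality)
open import Relation.Binary.PropositionalEquality
  using (_≡_; _≢_; refl; sym; trans; cong; cong₂; subst; subst₂; isEquivalence; module ≡-Reasoning)
open import Relation.Nullary using (¬_; Dec; yes; no; does)
open import Relation.Nullary.Decidable using (dec-true)

module OrderedFieldProperties {c ℓ} (F : OrderedField c ℓ) where
  open OrderedField F public renaming (+-mono-≤ to +-monoˡ-≤)

  commutativeRing : CommutativeRing c c
  commutativeRing = record
    { isCommutativeRing = record
      { isRing = record
        { +-isAbelianGroup = record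
          { isGroup = record
            { isMonoid = record
              { isSemigroup = record
                { isMagma = record { isEquivalence = isEquivalence ; ∙-cong = cong₂ _+_ }
                ; assoc = +-assoc }
              ; identity = comm∧idˡ⇒id +-comm +-identityˡ }
            ; inverse = comm∧invˡ⇒inv +-comm -‿inverseˡ
            ; ⁻¹-cong = cong -_ }
          ; comm = +-comm }
        ; *-cong = cong₂ _*_
        ; *-assoc = *-assoc
        ; *-identity = comm∧idˡ⇒id *-comm *-identityˡ
        ; distrib = distribˡ , comm∧distrˡ⇒distrʳ *-comm distribˡ }
      ; *-comm = *-comm } }

  open CommutativeRing commutativeRing public
    using (_-_; +-identityʳ; -‿inverseʳ; *-identityʳ; distribʳ; zeroˡ; zeroʳ)
  open RingProperties (CommutativeRing.ring commutativeRing) public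
    using (-‿involutive; -‿distribˡ-*; -‿distribʳ-*; -1*x≈-x; x[y-z]≈xy-xz)
  open CommutativeSemigroupProperties (CommutativeRing.+-commutativeSemigroup commutativeRing) public
    using () renaming (interchange to +-interchange)

  +-monoʳ-≤ : ∀ {x y} z → x ≤ y → z + x ≤ z + y
  +-monoʳ-≤ {x} {y} z x≤y = subst₂ _≤_ (+-comm x z) (+-comm y z) (+-monoˡ-≤ z x≤y)

  +-mono-≤ : ∀ {x y u v} → x ≤ y → u ≤ v → x + u ≤ y + v
  +-mono-≤ {y = y} {u} x≤y u≤v = ≤-trans (+-monoˡ-≤ u x≤y) (+-monoʳ-≤ y u≤v)

  +-nonneg : ∀ {x y} → 0# ≤ x → 0# ≤ y → 0# ≤ x + y
  +-nonneg 0≤x 0≤y = subst (_≤ _) (+-identityˡ 0#) (+-mono-≤ 0≤x 0≤y)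

  x≤x+y : ∀ x {y} → 0# ≤ y → x ≤ x + y
  x≤x+y x 0≤y = subst (_≤ x + _) (+-identityʳ x) (+-monoʳ-≤ x 0≤y)

  +-cancelˡ-≤ : ∀ {x y} z → z + x ≤ z + y → x ≤ y
  +-cancelˡ-≤ {x} {y} z z+x≤z+y = subst₂ _≤_ (cancel x) (cancel y) (+-monoʳ-≤ (- z) z+x≤z+y)
    where
    cancel : ∀ u → - z + (z + u) ≡ u
    cancel u = trans (sym (+-assoc (- z) z u)) (trans (cong (_+ u) (-‿inverseˡ z)) (+-identityˡ u))

  x≤y⇒0≤y-x : ∀ {x y} → x ≤ y → 0# ≤ y - x
  x≤y⇒0≤y-x {x} {y} x≤y = subst (_≤ y - x) (-‿inverseʳ x) (+-monoˡ-≤ (- x) x≤y)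

  0≤y-x⇒x≤y : ∀ {x y} → 0# ≤ y - x → x ≤ y
  0≤y-x⇒x≤y {x} {y} 0≤y-x = subst₂ _≤_ (+-identityˡ x) y-x+x≡y (+-monoˡ-≤ x 0≤y-x)
    where
    y-x+x≡y : y - x + x ≡ y
    y-x+x≡y = trans (+-assoc y (- x) x) (trans (cong (y +_) (-‿inverseˡ x)) (+-identityʳ y))

  neg-antitone-≤ : ∀ {x y} → x ≤ y → - y ≤ - x
  neg-antitone-≤ {x} {y} x≤y = 0≤y-x⇒x≤y (subst (0# ≤_) y-x≡-x--y (x≤y⇒0≤y-x x≤y))
    where
    y-x≡-x--y : y - x ≡ - x - - y
    y-x≡-x--y = trans (+-comm y (- x)) (cong (- x +_) (sym (-‿involutive y)))

  *-monoˡ-≤ : ∀ {x y} z → 0# ≤ z → x ≤ y → z * x ≤ z * y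
  *-monoˡ-≤ {x} {y} z 0≤z x≤y =
    0≤y-x⇒x≤y (subst (0# ≤_) (x[y-z]≈xy-xz z y x) (*-nonneg 0≤z (x≤y⇒0≤y-x x≤y)))

  0≤1 : 0# ≤ 1#
  0≤1 with ≤-total 0# 1#
  ... | inj₁ 0≤1 = 0≤1
  ... | inj₂ 1≤0 = subst (0# ≤_) (trans (-1*x≈-x (- 1#)) (-‿involutive 1#)) (*-nonneg 0≤-1 0≤-1)
    where
    0≤-1 : 0# ≤ - 1#
    0≤-1 = subst₂ _≤_ (-‿inverseʳ 1#) (+-identityˡ (- 1#)) (+-monoˡ-≤ (- 1#) 1≤0)

  *-cancelˡ-≤ : ∀ {x y z} → 0# ≤ z → z ≢ 0# → z * x ≤ z * y → x ≤ y
  *-cancelˡ-≤ {x} {y} {z} 0≤z z≢0 zx≤zy with inverse z z≢0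
  ... | z⁻¹ , zz⁻¹≡1 = subst₂ _≤_ (cancel x) (cancel y) (*-monoˡ-≤ z⁻¹ 0≤z⁻¹ zx≤zy)
    where
    cancel : ∀ u → z⁻¹ * (z * u) ≡ u
    cancel u = trans (sym (*-assoc z⁻¹ z u))
                 (trans (cong (_* u) (trans (*-comm z⁻¹ z) zz⁻¹≡1)) (*-identityˡ u))
    0≤z⁻¹ : 0# ≤ z⁻¹
    0≤z⁻¹ with ≤-total 0# z⁻¹
    ... | inj₁ 0≤z⁻¹ = 0≤z⁻¹
    ... | inj₂ z⁻¹≤0 =
      ⊥-elim (0≢1 (≤-antisym 0≤1 (subst₂ _≤_ zz⁻¹≡1 (zeroʳ z) (*-monoˡ-≤ z 0≤z z⁻¹≤0))))

  x+ay+[-a]y≡x : ∀ x a y → x + a * y + (- a) * y ≡ x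
  x+ay+[-a]y≡x x a y = begin
    x + a * y + (- a) * y    ≡⟨ +-assoc x (a * y) ((- a) * y) ⟩
    x + (a * y + (- a) * y)  ≡⟨ cong (x +_) (distribʳ y a (- a)) ⟨
    x + (a + - a) * y        ≡⟨ cong (λ b → x + b * y) (-‿inverseʳ a) ⟩
    x + 0# * y               ≡⟨ cong (x +_) (zeroˡ y) ⟩
    x + 0#                   ≡⟨ +-identityʳ x ⟩
    x                        ∎
    where open ≡-Reasoning

  x+ay+[-a]1≡[x-a]+ay : ∀ x a y → x + a * y + (- a) * 1# ≡ (x - a) + a * y
  x+ay+[-a]1≡[x-a]+ay x a y = begin
    x + a * y + (- a) * 1#   ≡⟨ cong (x + a * y +_) (*-identityʳ (- a)) ⟩
    x + a * y + - a          ≡⟨ +-assoc x (a * y) (- a) ⟩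
    x + (a * y + - a)        ≡⟨ cong (x +_) (+-comm (a * y) (- a)) ⟩
    x + (- a + a * y)        ≡⟨ +-assoc x (- a) (a * y) ⟨
    (x - a) + a * y          ∎
    where open ≡-Reasoning

  0≤ay+[-a]z : ∀ {a y z} → 0# ≤ a → z ≤ y → 0# ≤ a * y + (- a) * z
  0≤ay+[-a]z {a} {y} {z} 0≤a z≤y =
    subst (0# ≤_) a[y-z]≡ay+[-a]z (*-nonneg 0≤a (x≤y⇒0≤y-x z≤y))
    where
    a[y-z]≡ay+[-a]z : a * (y - z) ≡ a * y + (- a) * z
    a[y-z]≡ay+[-a]z = trans (distribˡ a y (- z))
                        (cong (a * y +_) (trans (sym (-‿distribʳ-* a z)) (-‿distribˡ-* a z)))

  x+[-ε]y≤[1-ε]x⇒x≤y : ∀ {x y ε} → 0# ≤ ε → ε ≢ 0# →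
                       x + (- ε) * y ≤ (1# - ε) * x → x ≤ y
  x+[-ε]y≤[1-ε]x⇒x≤y {x} {y} {ε} 0≤ε ε≢0 le = *-cancelˡ-≤ 0≤ε ε≢0 εx≤εy
    where
    [1-ε]x≡x+[-ε]x : (1# - ε) * x ≡ x + (- ε) * x
    [1-ε]x≡x+[-ε]x = trans (distribʳ x 1# (- ε)) (cong (_+ (- ε) * x) (*-identityˡ x))
    -εy≤-εx : - (ε * y) ≤ - (ε * x)
    -εy≤-εx = subst₂ _≤_ (sym (-‿distribˡ-* ε y)) (sym (-‿distribˡ-* ε x))
                (+-cancelˡ-≤ x (subst (x + (- ε) * y ≤_) [1-ε]x≡x+[-ε]x le))
    εx≤εy : ε * x ≤ ε * y
    εx≤εy = subst₂ _≤_ (-‿involutive (ε * x)) (-‿involutive (ε * y)) (neg-antitone-≤ -εy≤-εx)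

  argmin : ∀ {n} .{{_ : ℕ.NonZero n}} (f : Fin n → Carrier) → Σ (Fin n) λ i → ∀ j → f i ≤ f j
  argmin {suc zero}    f = zero , λ { zero → ≤-refl (f zero) }
  argmin {suc (suc n)} f with argmin (λ i → f (suc i))
  ... | i , min with ≤-total (f zero) (f (suc i))
  ...   | inj₁ f0≤ = zero  , λ { zero → ≤-refl (f zero) ; (suc j) → ≤-trans f0≤ (min j) }
  ...   | inj₂ ≤f0 = suc i , λ { zero → ≤f0 ; (suc j) → min j }

module FiniteSums {c ℓ} (F : OrderedField c ℓ) where
  open OrderedFieldProperties F
  open Matrices F using (∑)

  private variable
    n : ℕ
    f g : Fin n → Carrier

  ∑-cong : (∀ i → f i ≡ g i) → ∑ f ≡ ∑ g
  ∑-cong {zero}  eq = refl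
  ∑-cong {suc n} eq = cong₂ _+_ (eq zero) (∑-cong (λ i → eq (suc i)))

  ∑-zero : (∀ i → f i ≡ 0#) → ∑ f ≡ 0#
  ∑-zero {zero}  eq = refl
  ∑-zero {suc n} eq = trans (cong₂ _+_ (eq zero) (∑-zero (λ i → eq (suc i)))) (+-identityˡ 0#)

  ∑-distrib-+ : (f g : Fin n → Carrier) → ∑ (λ i → f i + g i) ≡ ∑ f + ∑ g
  ∑-distrib-+ {zero}  f g = sym (+-identityˡ 0#)
  ∑-distrib-+ {suc n} f g = begin
    (f zero + g zero) + ∑ (λ i → f (suc i) + g (suc i))
      ≡⟨ cong (f zero + g zero +_) (∑-distrib-+ (λ i → f (suc i)) (λ i → g (suc i))) ⟩
    (f zero + g zero) + (∑ (λ i → f (suc i)) + ∑ (λ i → g (suc i)))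
      ≡⟨ +-interchange (f zero) (g zero) _ _ ⟩
    (f zero + ∑ (λ i → f (suc i))) + (g zero + ∑ (λ i → g (suc i)))
      ∎
    where open ≡-Reasoning

  *-distribˡ-∑ : ∀ a (f : Fin n → Carrier) → a * ∑ f ≡ ∑ (λ i → a * f i)
  *-distribˡ-∑ {zero}  a f = zeroʳ a
  *-distribˡ-∑ {suc n} a f =
    trans (distribˡ a _ _) (cong (a * f zero +_) (*-distribˡ-∑ a (λ i → f (suc i))))

  ∑-comm : ∀ {m} (h : Fin n → Fin m → Carrier) →
           ∑ (λ i → ∑ (h i)) ≡ ∑ (λ j → ∑ (λ i → h i j))
  ∑-comm {zero} {m} h = sym (∑-zero {m} (λ _ → refl))
  ∑-comm {suc n}    h = trans (cong (∑ (h zero) +_) (∑-comm (λ i → h (suc i))))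
                              (sym (∑-distrib-+ (h zero) _))

  ∑-mono-≤ : (∀ i → f i ≤ g i) → ∑ f ≤ ∑ g
  ∑-mono-≤ {zero}  f≤g = ≤-refl 0#
  ∑-mono-≤ {suc n} f≤g = +-mono-≤ (f≤g zero) (∑-mono-≤ (λ i → f≤g (suc i)))

  ∑-nonneg : (∀ i → 0# ≤ f i) → 0# ≤ ∑ f
  ∑-nonneg {n} {f} 0≤f = subst (_≤ ∑ f) (∑-zero {n} (λ _ → refl)) (∑-mono-≤ 0≤f)

  term≤∑ : (∀ i → 0# ≤ f i) → ∀ a → f a ≤ ∑ f
  term≤∑ {suc n} {f} 0≤f zero =
    subst (_≤ ∑ f) (+-identityʳ (f zero)) (+-monoʳ-≤ (f zero) (∑-nonneg (λ i → 0≤f (suc i))))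
  term≤∑ {suc n} {f} 0≤f (suc a) =
    subst (_≤ ∑ f) (+-identityˡ _) (+-mono-≤ (0≤f zero) (term≤∑ (λ i → 0≤f (suc i)) a))

  twoTerms≤∑ : (∀ i → 0# ≤ f i) → ∀ {a b} → a ≢ b → f a + f b ≤ ∑ f
  twoTerms≤∑ 0≤f {zero}  {zero}  a≢b = ⊥-elim (a≢b refl)
  twoTerms≤∑ 0≤f {zero}  {suc b} a≢b = +-monoʳ-≤ _ (term≤∑ (λ i → 0≤f (suc i)) b)
  twoTerms≤∑ {f = f} 0≤f {suc a} {zero} a≢b =
    subst (_≤ ∑ f) (+-comm (f zero) _) (+-monoʳ-≤ (f zero) (term≤∑ (λ i → 0≤f (suc i)) a))
  twoTerms≤∑ {f = f} 0≤f {suc a} {suc b} a≢b =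
    subst (_≤ ∑ f) (+-identityˡ _)
      (+-mono-≤ (0≤f zero) (twoTerms≤∑ (λ i → 0≤f (suc i)) (λ a≡b → a≢b (cong suc a≡b))))

  ∑-nonneg-zero : (∀ i → 0# ≤ f i) → ∑ f ≡ 0# → ∀ i → f i ≡ 0#
  ∑-nonneg-zero 0≤f ∑f≡0 i = ≤-antisym (subst (_ ≤_) ∑f≡0 (term≤∑ 0≤f i)) (0≤f i)

  ∑-nonneg-attained : (∀ i → 0# ≤ f i) → ∀ {a} → ∑ f ≡ f a → ∀ {b} → b ≢ a → f b ≡ 0#
  ∑-nonneg-attained {f = f} 0≤f {a} ∑f≡fa {b} b≢a =
    ≤-antisym (+-cancelˡ-≤ (f a) fa+fb≤fa+0) (0≤f b)
    where
    fa+fb≤fa+0 : f a + f b ≤ f a + 0#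
    fa+fb≤fa+0 = subst (f a + f b ≤_) (trans ∑f≡fa (sym (+-identityʳ (f a))))
                   (twoTerms≤∑ 0≤f (λ a≡b → b≢a (sym a≡b)))

  ∑-single : ∀ a → (∀ j → j ≢ a → f j ≡ 0#) → ∑ f ≡ f a
  ∑-single {suc n} {f} zero others≡0 =
    trans (cong (f zero +_) (∑-zero (λ i → others≡0 (suc i) λ ()))) (+-identityʳ (f zero))
  ∑-single {suc n} {f} (suc a) others≡0 =
    trans (cong (_+ ∑ (λ i → f (suc i))) (others≡0 zero λ ()))
      (trans (+-identityˡ _)
             (∑-single a (λ j j≢a → others≡0 (suc j) (λ sj≡sa → j≢a (suc-injective sj≡sa)))))

  ∑-last : ∀ K (g : ℕ → Carrier) → ∑ {suc K} (λ k → g (toℕ k)) ≡ ∑ {K} (λ k → g (toℕ k)) + g K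
  ∑-last zero    g = trans (+-identityʳ (g 0)) (sym (+-identityˡ (g 0)))
  ∑-last (suc K) g = trans (cong (g 0 +_) (∑-last K (λ k → g (suc k)))) (sym (+-assoc (g 0) _ _))

  ∑-rotate : ∀ K (g : ℕ → Carrier) → g 0 ≡ g K →
             ∑ {K} (λ k → g (toℕ k)) ≡ ∑ {K} (λ k → g (suc (toℕ k)))
  ∑-rotate zero    g _     = refl
  ∑-rotate (suc K) g g0≡gK =
    trans (cong (_+ rest) g0≡gK) (trans (+-comm (g (suc K)) rest) (sym (∑-last K (λ k → g (suc k)))))
    where
    rest : Carrier
    rest = ∑ {K} (λ k → g (suc (toℕ k)))

  δ : Fin n → Fin n → Carrier
  δ a b with a ≟ b
  ... | yes _ = 1#
  ... | no  _ = 0#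

  δ-refl : ∀ (a : Fin n) → δ a a ≡ 1#
  δ-refl a with a ≟ a
  ... | yes _  = refl
  ... | no a≢a = ⊥-elim (a≢a refl)

  δ-≢ : ∀ {a b : Fin n} → a ≢ b → δ a b ≡ 0#
  δ-≢ {a = a} {b} a≢b with a ≟ b
  ... | yes a≡b = ⊥-elim (a≢b a≡b)
  ... | no  _   = refl

  δ-nonneg : ∀ (a b : Fin n) → 0# ≤ δ a b
  δ-nonneg a b with a ≟ b
  ... | yes _ = 0≤1
  ... | no  _ = ≤-refl 0#

  ∑-δ : ∀ (a : Fin n) → ∑ (δ a) ≡ 1#
  ∑-δ a = trans (∑-single a (λ j j≢a → δ-≢ (λ a≡j → j≢a (sym a≡j)))) (δ-refl a)

module MatrixAlgebra {c ℓ} (F : OrderedField c ℓ) where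
  open OrderedFieldProperties F
  open FiniteSums F
  open Matrices F

  private variable
    n K : ℕ

  infixl 6 _+ᴹ_
  infixr 7 _·ᴹ_

  _+ᴹ_ : Matrix n → Matrix n → Matrix n
  (A +ᴹ B) i j = A i j + B i j

  _·ᴹ_ : Carrier → Matrix n → Matrix n
  (a ·ᴹ A) i j = a * A i j

  ∑ᴹ : (Fin K → Matrix n) → Matrix n
  ∑ᴹ A i j = ∑ λ k → A k i j

  ⟨_,_⟩ : Matrix n → Matrix n → Carrier
  ⟨ A , B ⟩ = ∑ λ i → ∑ λ j → A i j * B i j

  rowSum colSum : Matrix n → Fin n → Carrier
  rowSum A i = ∑ (A i)
  colSum A = rowSum (transpose A)

  rowSum-+ᴹ·ᴹ : ∀ (A : Matrix n) a B i → rowSum (A +ᴹ a ·ᴹ B) i ≡ rowSum A i + a * rowSum B i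
  rowSum-+ᴹ·ᴹ A a B i =
    trans (∑-distrib-+ (A i) (λ j → a * B i j)) (cong (rowSum A i +_) (sym (*-distribˡ-∑ a (B i))))

  rowSum-∑ᴹ : ∀ (A : Fin K → Matrix n) i → rowSum (∑ᴹ A) i ≡ ∑ λ k → rowSum (A k) i
  rowSum-∑ᴹ A i = ∑-comm (λ j k → A k i j)

  ⟨⟩-cong : ∀ {A B : Matrix n} E → (∀ i j → A i j ≡ B i j) → ⟨ A , E ⟩ ≡ ⟨ B , E ⟩
  ⟨⟩-cong E A≡B = ∑-cong λ i → ∑-cong λ j → cong (_* E i j) (A≡B i j)

  ⟨⟩-·ᴹ : ∀ a (A E : Matrix n) → ⟨ a ·ᴹ A , E ⟩ ≡ a * ⟨ A , E ⟩
  ⟨⟩-·ᴹ a A E = begin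
    ∑ (λ i → ∑ λ j → a * A i j * E i j)
      ≡⟨ ∑-cong (λ i → ∑-cong λ j → *-assoc a (A i j) (E i j)) ⟩
    ∑ (λ i → ∑ λ j → a * (A i j * E i j))
      ≡⟨ ∑-cong (λ i → *-distribˡ-∑ a (λ j → A i j * E i j)) ⟨
    ∑ (λ i → a * ∑ λ j → A i j * E i j)
      ≡⟨ *-distribˡ-∑ a (λ i → ∑ λ j → A i j * E i j) ⟨
    a * ⟨ A , E ⟩
      ∎
    where open ≡-Reasoning

  ⟨⟩-+ᴹ·ᴹ : ∀ (A : Matrix n) a B E → ⟨ A +ᴹ a ·ᴹ B , E ⟩ ≡ ⟨ A , E ⟩ + a * ⟨ B , E ⟩
  ⟨⟩-+ᴹ·ᴹ A a B E = begin
    ∑ (λ i → ∑ λ j → (A i j + a * B i j) * E i j)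
      ≡⟨ ∑-cong (λ i → ∑-cong λ j → distribʳ (E i j) (A i j) (a * B i j)) ⟩
    ∑ (λ i → ∑ λ j → A i j * E i j + a * B i j * E i j)
      ≡⟨ ∑-cong (λ i → ∑-distrib-+ (λ j → A i j * E i j) _) ⟩
    ∑ (λ i → ∑ (λ j → A i j * E i j) + ∑ (λ j → a * B i j * E i j))
      ≡⟨ ∑-distrib-+ (λ i → ∑ λ j → A i j * E i j) _ ⟩
    ⟨ A , E ⟩ + ⟨ a ·ᴹ B , E ⟩
      ≡⟨ cong (⟨ A , E ⟩ +_) (⟨⟩-·ᴹ a B E) ⟩
    ⟨ A , E ⟩ + a * ⟨ B , E ⟩
      ∎
    where open ≡-Reasoning

  ⟨⟩-∑ᴹ : ∀ (A : Fin K → Matrix n) E → ⟨ ∑ᴹ A , E ⟩ ≡ ∑ λ k → ⟨ A k , E ⟩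
  ⟨⟩-∑ᴹ A E = begin
    ∑ (λ i → ∑ λ j → ∑ (λ k → A k i j) * E i j)
      ≡⟨ ∑-cong (λ i → ∑-cong λ j → ∑-distribʳ-* (E i j) (λ k → A k i j)) ⟩
    ∑ (λ i → ∑ λ j → ∑ λ k → A k i j * E i j)
      ≡⟨ ∑-cong (λ i → ∑-comm λ j k → A k i j * E i j) ⟩
    ∑ (λ i → ∑ λ k → ∑ λ j → A k i j * E i j)
      ≡⟨ ∑-comm (λ i k → ∑ λ j → A k i j * E i j) ⟩
    ∑ (λ k → ⟨ A k , E ⟩)
      ∎
    where
    open ≡-Reasoning
    ∑-distribʳ-* : ∀ a (f : Fin K → Carrier) → ∑ f * a ≡ ∑ λ k → f k * a
    ∑-distribʳ-* a f =
      trans (*-comm (∑ f) a) (trans (*-distribˡ-∑ a f) (∑-cong λ k → *-comm a (f k)))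

  record IsScaledBistochastic (t : Carrier) (X : Matrix n) : Set (c ⊔ ℓ) where
    field
      nonneg  : ∀ i j → 0# ≤ X i j
      rowSum≡ : ∀ i → rowSum X i ≡ t
      colSum≡ : ∀ j → colSum X j ≡ t

  transpose-scaled : ∀ {t} {X : Matrix n} →
                     IsScaledBistochastic t X → IsScaledBistochastic t (transpose X)
  transpose-scaled X-scaled =
    record { nonneg = λ i j → nonneg j i ; rowSum≡ = colSum≡ ; colSum≡ = rowSum≡ }
    where open IsScaledBistochastic X-scaled

  bistochastic-scaled : ∀ {E : Matrix n} → Bistochastic E → IsScaledBistochastic 1# E
  bistochastic-scaled (entries , rows , cols) =
    record { nonneg = λ i j → proj₁ (entries i j) ; rowSum≡ = rows ; colSum≡ = cols }

  ⟨⟩-scaled-0 : ∀ {X : Matrix n} → IsScaledBistochastic 0# X → ∀ E → ⟨ X , E ⟩ ≡ 0#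
  ⟨⟩-scaled-0 {n} X-scaled E = ∑-zero {n} λ i → ∑-zero {n} λ j →
    trans (cong (_* E i j) (∑-nonneg-zero (nonneg i) (rowSum≡ i) j)) (zeroˡ (E i j))
    where open IsScaledBistochastic X-scaled

  unitMatrix : Fin n × Fin n → Matrix n
  unitMatrix (a , b) i j = δ a i * δ b j

  unitMatrix-≢ : ∀ {p : Fin n × Fin n} {i j} → p ≢ (i , j) → unitMatrix p i j ≡ 0#
  unitMatrix-≢ {p = a , b} {i} {j} p≢ij = vanish (a ≟ i) (b ≟ j)
    where
    vanish : Dec (a ≡ i) → Dec (b ≡ j) → δ a i * δ b j ≡ 0#
    vanish (no a≢i)   _          = trans (cong (_* δ b j) (δ-≢ a≢i)) (zeroˡ (δ b j))
    vanish (yes _)    (no b≢j)   = trans (cong (δ a i *_) (δ-≢ b≢j)) (zeroʳ (δ a i))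
    vanish (yes refl) (yes refl) = ⊥-elim (p≢ij refl)

  unitMatrix-diag : ∀ (a b : Fin n) → unitMatrix (a , b) a b ≡ 1#
  unitMatrix-diag a b = trans (cong₂ _*_ (δ-refl a) (δ-refl b)) (*-identityˡ 1#)

  unitMatrix-nonneg : ∀ (p : Fin n × Fin n) i j → 0# ≤ unitMatrix p i j
  unitMatrix-nonneg (a , b) i j = *-nonneg (δ-nonneg a i) (δ-nonneg b j)

  rowSum-unitMatrix : ∀ (a b : Fin n) i → rowSum (unitMatrix (a , b)) i ≡ δ a i
  rowSum-unitMatrix a b i = trans (sym (*-distribˡ-∑ (δ a i) (δ b)))
                              (trans (cong (δ a i *_) (∑-δ b)) (*-identityʳ (δ a i)))

  colSum-unitMatrix : ∀ (a b : Fin n) j → colSum (unitMatrix (a , b)) j ≡ δ b j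
  colSum-unitMatrix a b j = trans (∑-cong λ i → *-comm (δ a i) (δ b j)) (rowSum-unitMatrix b a j)

  ⟨unitMatrix⟩ : ∀ (a b : Fin n) E → ⟨ unitMatrix (a , b) , E ⟩ ≡ E a b
  ⟨unitMatrix⟩ {n} a b E = begin
    ⟨ unitMatrix (a , b) , E ⟩
      ≡⟨ ∑-single a (λ i i≢a → ∑-zero {n} λ j → vanish (λ { refl → i≢a refl })) ⟩
    ∑ (λ j → unitMatrix (a , b) a j * E a j)
      ≡⟨ ∑-single b (λ j j≢b → vanish (λ { refl → j≢b refl })) ⟩
    unitMatrix (a , b) a b * E a b
      ≡⟨ trans (cong (_* E a b) (unitMatrix-diag a b)) (*-identityˡ (E a b)) ⟩
    E a b
      ∎
    where
    open ≡-Reasoning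
    vanish : ∀ {i j} → (a , b) ≢ (i , j) → unitMatrix (a , b) i j * E i j ≡ 0#
    vanish ab≢ij = trans (cong (_* _) (unitMatrix-≢ ab≢ij)) (zeroˡ _)

  indicator : (Fin K → Fin n × Fin n) → Matrix n
  indicator Q = ∑ᴹ λ k → unitMatrix (Q k)

  module _ (Q : Fin K → Fin n × Fin n) where

    indicator-hit : Injective _≡_ _≡_ Q → ∀ l → uncurry (indicator Q) (Q l) ≡ 1#
    indicator-hit Q-injective l =
      trans (∑-single l λ k k≢l → unitMatrix-≢ λ Qk≡Ql → k≢l (Q-injective Qk≡Ql))
            (unitMatrix-diag (proj₁ (Q l)) (proj₂ (Q l)))

    indicator-miss : ∀ {i j} → (∀ k → Q k ≢ (i , j)) → indicator Q i j ≡ 0#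
    indicator-miss missed = ∑-zero {K} λ k → unitMatrix-≢ (missed k)

    indicator-nonneg : ∀ i j → 0# ≤ indicator Q i j
    indicator-nonneg i j = ∑-nonneg λ k → unitMatrix-nonneg (Q k) i j

    rowSum-indicator : ∀ i → rowSum (indicator Q) i ≡ ∑ λ k → δ (proj₁ (Q k)) i
    rowSum-indicator i = trans (rowSum-∑ᴹ (λ k → unitMatrix (Q k)) i)
                               (∑-cong λ k → rowSum-unitMatrix (proj₁ (Q k)) (proj₂ (Q k)) i)

    colSum-indicator : ∀ j → colSum (indicator Q) j ≡ ∑ λ k → δ (proj₂ (Q k)) j
    colSum-indicator j = trans (rowSum-∑ᴹ (λ k → transpose (unitMatrix (Q k))) j)
                               (∑-cong λ k → colSum-unitMatrix (proj₁ (Q k)) (proj₂ (Q k)) j)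

    ⟨indicator⟩ : ∀ E → ⟨ indicator Q , E ⟩ ≡ ∑ λ k → uncurry E (Q k)
    ⟨indicator⟩ E = trans (⟨⟩-∑ᴹ (λ k → unitMatrix (Q k)) E)
                          (∑-cong λ k → ⟨unitMatrix⟩ (proj₁ (Q k)) (proj₂ (Q k)) E)

  permMatrix-δ : ∀ (σ : Permutation′ n) i j → permMatrix σ i j ≡ δ (σ ⟨$⟩ʳ i) j
  permMatrix-δ σ i j with (σ ⟨$⟩ʳ i) ≟ j
  ... | yes _ = refl
  ... | no  _ = refl

  permMatrix-scaled : ∀ (σ : Permutation′ n) → IsScaledBistochastic 1# (permMatrix σ)
  permMatrix-scaled σ = record
    { nonneg  = λ i j → subst (0# ≤_) (sym (permMatrix-δ σ i j)) (δ-nonneg (σ ⟨$⟩ʳ i) j)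
    ; rowSum≡ = λ i → trans (∑-cong (permMatrix-δ σ i)) (∑-δ (σ ⟨$⟩ʳ i))
    ; colSum≡ = λ j → trans (∑-single (σ ⟨$⟩ˡ j) (λ i → off-σ⁻¹ {i})) (at-σ⁻¹ j)
    }
    where
    off-σ⁻¹ : ∀ {i j} → i ≢ σ ⟨$⟩ˡ j → permMatrix σ i j ≡ 0#
    off-σ⁻¹ {i} {j} i≢σ⁻¹j = trans (permMatrix-δ σ i j)
      (δ-≢ λ σi≡j → i≢σ⁻¹j (trans (sym (inverseˡ σ)) (cong (σ ⟨$⟩ˡ_) σi≡j)))
    at-σ⁻¹ : ∀ j → permMatrix σ (σ ⟨$⟩ˡ j) j ≡ 1#
    at-σ⁻¹ j = trans (permMatrix-δ σ _ j) (trans (cong (λ k → δ k j) (inverseʳ σ)) (δ-refl j))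

  trσ≡⟨permMatrix⟩ : ∀ (σ : Permutation′ n) M → trσ σ M ≡ ⟨ permMatrix σ , M ⟩
  trσ≡⟨permMatrix⟩ σ M = ∑-comm λ i k → permMatrix σ k i * M k i

module Marking where
  private variable
    n : ℕ
    p q : Level

  ∃-or-∀ : {P : Fin n → Set p} {Q : Fin n → Set q} → (∀ i → P i ⊎ Q i) → ∃ P ⊎ (∀ i → Q i)
  ∃-or-∀ {zero}  P⊎Q = inj₂ λ ()
  ∃-or-∀ {suc n} P⊎Q with P⊎Q zero | ∃-or-∀ (λ i → P⊎Q (suc i))
  ... | inj₁ P0 | _              = inj₁ (zero , P0)
  ... | inj₂ _  | inj₁ (i , Psi) = inj₁ (suc i , Psi)
  ... | inj₂ Q0 | inj₂ Qs        = inj₂ λ { zero → Q0 ; (suc i) → Qs i }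

  -- Z i j ≡ true records that entry (i , j) is known to vanish; the other entries are open.
  Marks : ℕ → Set
  Marks n = Fin n → Fin n → Bool

  Closed : (Fin n → Bool) → Set
  Closed f = ∀ k → f k ≡ true

  OnlyOpen : (Fin n → Bool) → Fin n → Set
  OnlyOpen f k = f k ≡ false × (∀ k′ → f k′ ≡ false → k′ ≡ k)

  SeveralOpen : (Fin n → Bool) → Set
  SeveralOpen f = ∃₂ λ k k′ → k ≢ k′ × f k ≡ false × f k′ ≡ false

  data LineShape (f : Fin n → Bool) : Set where
    closed  : Closed f → LineShape f
    single  : ∀ k → OnlyOpen f k → LineShape f
    several : SeveralOpen f → LineShape f

  private
    false-or-true : ∀ b → b ≡ false ⊎ b ≡ true
    false-or-true false = inj₁ refl
    false-or-true true  = inj₂ refl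

    otherOpen : (f : Fin n → Bool) → ∀ k k′ → (k′ ≢ k × f k′ ≡ false) ⊎ (f k′ ≡ false → k′ ≡ k)
    otherOpen f k k′ with k′ ≟ k | f k′
    ... | yes k′≡k | _     = inj₂ λ _ → k′≡k
    ... | no  k′≢k | false = inj₁ (k′≢k , refl)
    ... | no  _    | true  = inj₂ λ ()

  lineShape : (f : Fin n → Bool) → LineShape f
  lineShape f with ∃-or-∀ (λ k → false-or-true (f k))
  ... | inj₂ allClosed = closed allClosed
  ... | inj₁ (k , fk) with ∃-or-∀ (otherOpen f k)
  ...   | inj₁ (k′ , k′≢k , fk′) = several (k′ , k , k′≢k , fk′ , fk)
  ...   | inj₂ onlyK             = single k (fk , onlyK)

  onlyOpen-severalOpen : ∀ {f : Fin n → Bool} {k} → OnlyOpen f k → ¬ SeveralOpen f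
  onlyOpen-severalOpen (_ , only) (a , b , a≢b , fa , fb) = a≢b (trans (only a fa) (sym (only b fb)))

  otherThan : ∀ {f : Fin n → Bool} → SeveralOpen f → ∀ c → ∃ λ k → k ≢ c × f k ≡ false
  otherThan (a , b , a≢b , fa , fb) c with a ≟ c
  ... | yes refl = b , (λ b≡a → a≢b (sym b≡a)) , fb
  ... | no  a≢c  = a , a≢c , fa

  closed-or-open : (Z : Marks n) → (∃ λ i → Closed (Z i)) ⊎ (∀ i → ∃ λ j → Z i j ≡ false)
  closed-or-open Z = ∃-or-∀ λ i → shape (lineShape (Z i))
    where
    shape : ∀ {f : Fin n → Bool} → LineShape f → Closed f ⊎ ∃ λ k → f k ≡ false
    shape (closed allClosed)             = inj₁ allClosed
    shape (single k (fk , _))            = inj₂ (k , fk)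
    shape (several (k , _ , _ , fk , _)) = inj₂ (k , fk)

  several-or-singles : (Z : Marks n) → (∀ i → ∃ λ j → Z i j ≡ false) →
                       (∃ λ i → SeveralOpen (Z i)) ⊎ (∀ i → ∃ (OnlyOpen (Z i)))
  several-or-singles Z rowsOpen = ∃-or-∀ λ i → shape (rowsOpen i) (lineShape (Z i))
    where
    shape : ∀ {f : Fin n → Bool} → ∃ (λ k → f k ≡ false) → LineShape f →
            SeveralOpen f ⊎ ∃ (OnlyOpen f)
    shape (k , fk) (closed allClosed) = case trans (sym fk) (allClosed k) of λ ()
    shape _        (single k only)    = inj₂ (k , only)
    shape _        (several sev)      = inj₁ sev

  ∑ℕ : (Fin n → ℕ) → ℕ
  ∑ℕ {zero}  f = 0
  ∑ℕ {suc n} f = f zero ℕ.+ ∑ℕ (λ i → f (suc i))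

  ∑ℕ-mono-≤ : ∀ {f g : Fin n → ℕ} → (∀ i → f i ℕ.≤ g i) → ∑ℕ f ℕ.≤ ∑ℕ g
  ∑ℕ-mono-≤ {zero}  f≤g = ℕ.z≤n
  ∑ℕ-mono-≤ {suc n} f≤g = ℕ.+-mono-≤ (f≤g zero) (∑ℕ-mono-≤ (λ i → f≤g (suc i)))

  ∑ℕ-mono-< : ∀ {f g : Fin n → ℕ} → (∀ i → f i ℕ.≤ g i) → ∀ a → f a ℕ.< g a → ∑ℕ f ℕ.< ∑ℕ g
  ∑ℕ-mono-< {suc n} f≤g zero    fa<ga =
    ℕ.+-mono-<-≤ fa<ga (∑ℕ-mono-≤ (λ i → f≤g (suc i)))
  ∑ℕ-mono-< {suc n} f≤g (suc a) fa<ga =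
    ℕ.+-mono-≤-< (f≤g zero) (∑ℕ-mono-< (λ i → f≤g (suc i)) a fa<ga)

  openCount : Marks n → ℕ
  openCount Z = ∑ℕ λ i → ∑ℕ λ j → if Z i j then 0 else 1

  mark : Marks n → Fin n → Fin n → Marks n
  mark Z a b i j = Z i j ∨ (does (i ≟ a) ∧ does (j ≟ b))

  mark-true : ∀ (Z : Marks n) {a b i j} → mark Z a b i j ≡ true →
              Z i j ≡ true ⊎ (i ≡ a × j ≡ b)
  mark-true Z {a} {b} {i} {j} marked with Z i j | i ≟ a | j ≟ b
  ... | true  | _       | _       = inj₁ refl
  ... | false | yes i≡a | yes j≡b = inj₂ (i≡a , j≡b)
  ... | false | yes _   | no  _   = case marked of λ ()
  ... | false | no  _   | _       = case marked of λ ()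

  openCount-mark : ∀ (Z : Marks n) {a b} → Z a b ≡ false → openCount (mark Z a b) ℕ.< openCount Z
  openCount-mark Z {a} {b} Zab≡false =
    ∑ℕ-mono-< (λ i → ∑ℕ-mono-≤ λ j → open-∨ (Z i j) _) a
      (∑ℕ-mono-< (λ j → open-∨ (Z a j) _) b closes)
    where
    open-∨ : ∀ x y → (if x ∨ y then 0 else 1) ℕ.≤ (if x then 0 else 1)
    open-∨ true  y     = ℕ.z≤n
    open-∨ false true  = ℕ.z≤n
    open-∨ false false = ℕ.≤-refl
    closes : (if mark Z a b a b then 0 else 1) ℕ.< (if Z a b then 0 else 1)
    closes rewrite Zab≡false | dec-true (a ≟ a) refl | dec-true (b ≟ b) refl = ℕ.z<s

  SinglesIsolated : Marks n → Set
  SinglesIsolated Z = ∀ i j → OnlyOpen (Z i) j → ∀ i′ → Z i′ j ≡ false → i′ ≡ i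

  Shadowed : Marks n → Fin n → Fin n → Set
  Shadowed Z i′ j = ∃ λ i → i′ ≢ i × OnlyOpen (Z i) j

  private
    rowShadowed-or-isolated : (Z : Marks n) → ∀ i →
      (∃₂ λ i′ j → Z i′ j ≡ false × i′ ≢ i × OnlyOpen (Z i) j) ⊎
      (∀ j → OnlyOpen (Z i) j → ∀ i′ → Z i′ j ≡ false → i′ ≡ i)
    rowShadowed-or-isolated Z i with lineShape (Z i)
    ... | closed allClosed = inj₂ λ j only _ _ → case trans (sym (proj₁ only)) (allClosed j) of λ ()
    ... | several sev      = inj₂ λ j only _ _ → ⊥-elim (onlyOpen-severalOpen only sev)
    ... | single j only with ∃-or-∀ (otherOpen (flip Z j) i)
    ...   | inj₁ (i′ , i′≢i , Zi′j) = inj₁ (i′ , j , Zi′j , i′≢i , only)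
    ...   | inj₂ onlyI              = inj₂ λ j′ only′ i′ Zi′j′ →
      onlyI i′ (subst (λ k → Z i′ k ≡ false) (proj₂ only j′ (proj₁ only′)) Zi′j′)

  shadowed-or-isolated : (Z : Marks n) →
                         (∃₂ λ i′ j → Z i′ j ≡ false × Shadowed Z i′ j) ⊎ SinglesIsolated Z
  shadowed-or-isolated Z with ∃-or-∀ (rowShadowed-or-isolated Z)
  ... | inj₁ (i , i′ , j , Zi′j , i′≢i , only) = inj₁ (i′ , j , Zi′j , i , i′≢i , only)
  ... | inj₂ isolated                          = inj₂ isolated

  onlyOpenPermutation : ∀ {Z : Marks n} → (∀ i → ∃ (OnlyOpen (Z i))) →
                        (∀ j → ∃ λ i → Z i j ≡ false) → SinglesIsolated Z →
                        ∃ λ (σ : Permutation′ n) → ∀ i → OnlyOpen (Z i) (σ ⟨$⟩ʳ i)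
  onlyOpenPermutation {n} {Z} singles colsOpen isolated =
    permutation π ρ πρ≡id ρπ≡id , λ i → proj₂ (singles i)
    where
    π ρ : Fin n → Fin n
    π i = proj₁ (singles i)
    ρ j = proj₁ (colsOpen j)
    πρ≡id : ∀ j → π (ρ j) ≡ j
    πρ≡id j = sym (proj₂ (proj₂ (singles (ρ j))) j (proj₂ (colsOpen j)))
    ρπ≡id : ∀ i → ρ (π i) ≡ i
    ρπ≡id i = isolated i (π i) (proj₂ (singles i)) (ρ (π i)) (proj₂ (colsOpen (π i)))

  severalOpen-propagates : ∀ {Z : Marks n} {i j} → SinglesIsolated (flip Z) →
                           SeveralOpen (Z i) → Z i j ≡ false → SeveralOpen (flip Z j)
  severalOpen-propagates {Z = Z} {i} {j} isolatedᵀ sev Zij with lineShape (flip Z j)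
  ... | closed allClosed = case trans (sym Zij) (allClosed i) of λ ()
  ... | several sevᵀ     = sevᵀ
  ... | single i₀ only with proj₂ only i Zij
  ...   | refl = ⊥-elim (onlyOpen-severalOpen (Zij , λ j′ → isolatedᵀ j i only j′) sev)

  record AlternatingWalk (Z : Marks n) : Set where
    field
      row col     : ℕ → Fin n
      open-at     : ∀ k → Z (row k) (col k) ≡ false
      open-after  : ∀ k → Z (row (suc k)) (col k) ≡ false
      row-changes : ∀ k → row (suc k) ≢ row k
      col-changes : ∀ k → col (suc k) ≢ col k

  transposeWalk : ∀ {Z : Marks n} → AlternatingWalk Z → AlternatingWalk (flip Z)
  transposeWalk w = record
    { row = col ; col = λ k → row (suc k)
    ; open-at = open-after ; open-after = λ k → open-at (suc k)
    ; row-changes = col-changes ; col-changes = λ k → row-changes (suc k) }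
    where open AlternatingWalk w

  module _ {Z : Marks n} (isolated : SinglesIsolated Z) (isolatedᵀ : SinglesIsolated (flip Z)) where

    private
      record Position : Set where
        constructor at
        field
          i j      : Fin n
          open-ij  : Z i j ≡ false
          severalᶜ : SeveralOpen (flip Z j)
      open Position

      start : ∀ {i} → SeveralOpen (Z i) → Position
      start sev@(j , _ , _ , Zij , _) = at _ j Zij (severalOpen-propagates isolatedᵀ sev Zij)

      verticalMove : ∀ p → ∃ λ i′ → i′ ≢ i p × Z i′ (j p) ≡ false
      verticalMove p = otherThan (severalᶜ p) (i p)

      severalAfterVertical : ∀ p → SeveralOpen (Z (proj₁ (verticalMove p)))
      severalAfterVertical p =
        severalOpen-propagates isolated (severalᶜ p) (proj₂ (proj₂ (verticalMove p)))

      horizontalMove : ∀ p → ∃ λ j′ → j′ ≢ j p × Z (proj₁ (verticalMove p)) j′ ≡ false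
      horizontalMove p = otherThan (severalAfterVertical p) (j p)

      next : Position → Position
      next p = at _ _ open′ (severalOpen-propagates isolatedᵀ (severalAfterVertical p) open′)
        where
        open′ : Z (proj₁ (verticalMove p)) (proj₁ (horizontalMove p)) ≡ false
        open′ = proj₂ (proj₂ (horizontalMove p))

      position : ∀ {i} → SeveralOpen (Z i) → ℕ → Position
      position sev zero    = start sev
      position sev (suc k) = next (position sev k)

    alternatingWalk : ∀ {i} → SeveralOpen (Z i) → AlternatingWalk Z
    alternatingWalk sev = record
      { row         = λ k → i (position sev k)
      ; col         = λ k → j (position sev k)
      ; open-at     = λ k → open-ij (position sev k)
      ; open-after  = λ k → proj₂ (proj₂ (verticalMove (position sev k)))
      ; row-changes = λ k → proj₁ (proj₂ (verticalMove (position sev k)))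
      ; col-changes = λ k → proj₁ (proj₂ (horizontalMove (position sev k)))
      }

module FirstRepetition where
  private variable
    n : ℕ

  InjectiveBelow : ∀ {a} {A : Set a} → (ℕ → A) → ℕ → Set a
  InjectiveBelow f β = ∀ {x y} → x ℕ.< β → y ℕ.< β → f x ≡ f y → x ≡ y

  record Repeat (r c : ℕ → Fin n) : Set where
    field
      start period : ℕ
      period>0     : 0 ℕ.< period
      returns      : r start ≡ r (period ℕ.+ start)
      r-injective  : InjectiveBelow r (period ℕ.+ start)
      c-injective  : InjectiveBelow c (period ℕ.+ start)

  private
    ¬injectiveBelow-suc : (f : ℕ → Fin n) → ¬ InjectiveBelow f (suc n)
    ¬injectiveBelow-suc {n} f injective with pigeonhole (ℕ.n<1+n n) (λ x → f (toℕ x))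
    ... | x , y , x<y , fx≡fy = ℕ.<⇒≢ x<y (injective (toℕ<n x) (toℕ<n y) fx≡fy)

    repeat-or-extend : (f : ℕ → Fin n) → ∀ {β} → InjectiveBelow f β →
                       (∃ λ α → α ℕ.< β × f α ≡ f β) ⊎ InjectiveBelow f (suc β)
    repeat-or-extend f {β} injective with any? {n = β} (λ a → f (toℕ a) ≟ f β)
    ... | yes (a , fa≡fβ) = inj₁ (toℕ a , toℕ<n a , fa≡fβ)
    ... | no  fresh       = inj₂ extended
      where
      new : ∀ {x} → x ℕ.< β → f x ≢ f β
      new x<β fx≡fβ =
        fresh (Fin.fromℕ< x<β , subst (λ y → f y ≡ f β) (sym (toℕ-fromℕ< x<β)) fx≡fβ)
      extended : InjectiveBelow f (suc β)
      extended x<1+β y<1+β fx≡fy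
        with ℕ.m≤n⇒m<n∨m≡n (ℕ.≤-pred x<1+β) | ℕ.m≤n⇒m<n∨m≡n (ℕ.≤-pred y<1+β)
      ... | inj₁ x<β  | inj₁ y<β  = injective x<β y<β fx≡fy
      ... | inj₁ x<β  | inj₂ refl = ⊥-elim (new x<β fx≡fy)
      ... | inj₂ refl | inj₁ y<β  = ⊥-elim (new y<β (sym fx≡fy))
      ... | inj₂ refl | inj₂ refl = refl

    repeatAt : ∀ {r c : ℕ → Fin n} {α β} → α ℕ.< β → r α ≡ r β →
               InjectiveBelow r β → InjectiveBelow c β → Repeat r c
    repeatAt {α = α} {β} α<β rα≡rβ r-inj c-inj with β ℕ.∸ α | ℕ.m∸n+n≡m (ℕ.<⇒≤ α<β)
    ... | zero  | refl = ⊥-elim (ℕ.<-irrefl refl α<β)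
    ... | suc K | refl = record { start = α ; period = suc K ; period>0 = z<s ; returns = rα≡rβ
                                ; r-injective = r-inj ; c-injective = c-inj }

    scan : (r c : ℕ → Fin n) → ∀ fuel {β} → fuel ℕ.+ β ≡ suc n →
           InjectiveBelow r β → InjectiveBelow c β → Repeat r c ⊎ Repeat c (λ k → r (suc k))
    scan r c zero fuel+β≡1+n r-inj c-inj =
      ⊥-elim (¬injectiveBelow-suc r (subst (InjectiveBelow r) fuel+β≡1+n r-inj))
    scan r c (suc fuel) {β} fuel+β≡1+n r-inj c-inj with repeat-or-extend r r-inj
    ... | inj₁ (α , α<β , rα≡rβ) = inj₁ (repeatAt α<β rα≡rβ r-inj c-inj)
    ... | inj₂ r-inj′ with repeat-or-extend c c-inj
    ...   | inj₁ (α , α<β , cα≡cβ) =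
      inj₂ (repeatAt α<β cα≡cβ c-inj λ x<β y<β eq → ℕ.suc-injective (r-inj′ (s<s x<β) (s<s y<β) eq))
    ...   | inj₂ c-inj′ = scan r c fuel (trans (ℕ.+-suc fuel β) fuel+β≡1+n) r-inj′ c-inj′

  -- The first repetition in r 0, c 0, r 1, c 1, …; when it occurs in c, r is already injective
  -- one index further, which is why the second alternative is stated for r shifted by one.
  firstRepeat : (r c : ℕ → Fin n) → Repeat r c ⊎ Repeat c (λ k → r (suc k))
  firstRepeat {n} r c = scan r c (suc n) (ℕ.+-identityʳ (suc n)) (λ ()) (λ ())

module Cycles {c ℓ} (F : OrderedField c ℓ) where
  open Matrices F using (∑)
  open FiniteSums F using (δ; ∑-rotate)
  open Marking
  open FirstRepetition

  private variable
    n : ℕ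

  -- Adding the same amount at the plus entries and subtracting it at the minus entries
  -- preserves all line sums.
  record Cycle (Z : Marks n) : Set c where
    field
      length          : ℕ
      length>0        : 0 ℕ.< length
      plus minus      : Fin length → Fin n × Fin n
      plus-open       : ∀ k → uncurry Z (plus k) ≡ false
      minus-open      : ∀ k → uncurry Z (minus k) ≡ false
      plus-injective  : Injective _≡_ _≡_ plus
      minus-injective : Injective _≡_ _≡_ minus
      plus≢minus      : ∀ k l → plus k ≢ minus l
      rows-balanced   : ∀ i → ∑ (λ k → δ (proj₁ (plus k)) i) ≡ ∑ (λ k → δ (proj₁ (minus k)) i)
      cols-balanced   : ∀ j → ∑ (λ k → δ (proj₂ (plus k)) j) ≡ ∑ (λ k → δ (proj₂ (minus k)) j)

  reverse : ∀ {Z : Marks n} → Cycle Z → Cycle Z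
  reverse cy = record
    { length = length ; length>0 = length>0
    ; plus = minus ; minus = plus ; plus-open = minus-open ; minus-open = plus-open
    ; plus-injective = minus-injective ; minus-injective = plus-injective
    ; plus≢minus = λ k l minusk≡plusl → plus≢minus l k (sym minusk≡plusl)
    ; rows-balanced = λ i → sym (rows-balanced i) ; cols-balanced = λ j → sym (cols-balanced j) }
    where open Cycle cy

  transposeCycle : ∀ {Z : Marks n} → Cycle (flip Z) → Cycle Z
  transposeCycle cy = record
    { length = length ; length>0 = length>0
    ; plus = λ k → swap (plus k) ; minus = λ k → swap (minus k)
    ; plus-open = plus-open ; minus-open = minus-open
    ; plus-injective = λ eq → plus-injective (cong swap eq)
    ; minus-injective = λ eq → minus-injective (cong swap eq)
    ; plus≢minus = λ k l eq → plus≢minus k l (cong swap eq)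
    ; rows-balanced = cols-balanced ; cols-balanced = rows-balanced }
    where open Cycle cy

  private
    shifted-injective : ∀ {f : ℕ → Fin n} {K α} → InjectiveBelow f (K ℕ.+ α) →
                        Injective _≡_ _≡_ (λ (k : Fin K) → f (toℕ k ℕ.+ α))
    shifted-injective {K = K} {α} f-inj {k} {l} eq =
      toℕ-injective (ℕ.+-cancelʳ-≡ α (toℕ k) (toℕ l) (f-inj (bound k) (bound l) eq))
      where
      bound : ∀ (k : Fin K) → toℕ k ℕ.+ α ℕ.< K ℕ.+ α
      bound k = ℕ.+-monoˡ-< α (toℕ<n k)

  cycleFromRepeat : ∀ {Z : Marks n} (w : AlternatingWalk Z) →
                    let open AlternatingWalk w in Repeat row col → Cycle Z
  cycleFromRepeat w rep = record
    { length = period ; length>0 = period>0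
    ; plus  = λ k → row (at k) , col (at k)
    ; minus = λ k → row (suc (at k)) , col (at k)
    ; plus-open  = λ k → open-at (at k)
    ; minus-open = λ k → open-after (at k)
    ; plus-injective  = λ eq → col-injective (cong proj₂ eq)
    ; minus-injective = λ eq → col-injective (cong proj₂ eq)
    ; plus≢minus = plus≢minus
    ; rows-balanced = λ i → ∑-rotate period (λ x → δ (row (x ℕ.+ start)) i) (cong (λ r → δ r i) returns)
    ; cols-balanced = λ j → refl }
    where
    open AlternatingWalk w
    open Repeat rep
    at : Fin period → ℕ
    at k = toℕ k ℕ.+ start
    col-injective : Injective _≡_ _≡_ (λ k → col (at k))
    col-injective = shifted-injective c-injective
    plus≢minus : ∀ k l → (row (at k) , col (at k)) ≢ (row (suc (at l)) , col (at l))
    plus≢minus k l eq with col-injective (cong proj₂ eq)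
    ... | refl = row-changes (at k) (sym (cong proj₁ eq))

  cycleFromWalk : ∀ {Z : Marks n} → AlternatingWalk Z → Cycle Z
  cycleFromWalk w with firstRepeat (AlternatingWalk.row w) (AlternatingWalk.col w)
  ... | inj₁ rep = cycleFromRepeat w rep
  ... | inj₂ rep = transposeCycle (cycleFromRepeat (transposeWalk w) rep)

module MaxtraceBound {c ℓ} (F : OrderedField c ℓ) where
  open OrderedFieldProperties F
  open FiniteSums F
  open MatrixAlgebra F
  open Matrices F
  open Marking
  open Cycles F

  _≟ₑ_ : ∀ {n} → DecidableEquality (Fin n × Fin n)
  _≟ₑ_ = ≡-dec _≟_ _≟_

  module _ {n} (E : Matrix n) {m} (trσ≤m : ∀ σ → trσ σ E ≤ m) {t} (0≤t : 0# ≤ t) where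

    module _ {X : Matrix n} {Z : Marks n} (X-scaled : IsScaledBistochastic t X)
             (marked⇒0 : ∀ i j → Z i j ≡ true → X i j ≡ 0#) where
      open IsScaledBistochastic X-scaled

      closed⇒t≡0 : ∀ {i} → Closed (Z i) → t ≡ 0#
      closed⇒t≡0 {i} closedRow = trans (sym (rowSum≡ i)) (∑-zero λ j → marked⇒0 i j (closedRow j))

      onlyOpen⇒t : ∀ {i j} → OnlyOpen (Z i) j → X i j ≡ t
      onlyOpen⇒t {i} {j} (_ , only) = trans (sym (∑-single j others≡0)) (rowSum≡ i)
        where
        others≡0 : ∀ j′ → j′ ≢ j → X i j′ ≡ 0#
        others≡0 j′ j′≢j = marked⇒0 i j′ (¬-not λ Zij′≡false → j′≢j (only j′ Zij′≡false))

      shadowed⇒0 : ∀ {i′ j} → Shadowed Z i′ j → X i′ j ≡ 0#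
      shadowed⇒0 {i′} {j} (i , i′≢i , only) =
        ∑-nonneg-attained (λ k → nonneg k j) (trans (colSum≡ j) (sym (onlyOpen⇒t only))) i′≢i

    weight : ∀ {K} → (Fin K → Fin n × Fin n) → Carrier
    weight Q = ∑ λ k → uncurry E (Q k)

    record State : Set (c ⊔ ℓ) where
      field
        X        : Matrix n
        marks    : Marks n
        scaled   : IsScaledBistochastic t X
        marked⇒0 : ∀ i j → marks i j ≡ true → X i j ≡ 0#

    Bounded : State → Set ℓ
    Bounded s = ⟨ State.X s , E ⟩ ≤ t * m

    Improvement : State → Set (c ⊔ ℓ)
    Improvement s = Σ State λ s′ → ⟨ State.X s , E ⟩ ≤ ⟨ State.X s′ , E ⟩
                                 × openCount (State.marks s′) ℕ.< openCount (State.marks s)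

    module _ (s : State) where
      open State s
      open IsScaledBistochastic scaled

      scaledᵀ : IsScaledBistochastic t (transpose X)
      scaledᵀ = transpose-scaled scaled

      marked⇒0ᵀ : ∀ j i → flip marks j i ≡ true → X i j ≡ 0#
      marked⇒0ᵀ j i = marked⇒0 i j

      t≡0⇒bounded : t ≡ 0# → Bounded s
      t≡0⇒bounded refl = subst₂ _≤_ (sym (⟨⟩-scaled-0 scaled E)) (sym (zeroˡ m)) (≤-refl 0#)

      markZero : ∀ {i j} → X i j ≡ 0# → marks i j ≡ false → Improvement s
      markZero {i} {j} Xij≡0 open-ij =
        record { X = X ; marks = mark marks i j ; scaled = scaled ; marked⇒0 = marked⇒0′ } ,
        ≤-refl _ , openCount-mark marks open-ij
        where
        marked⇒0′ : ∀ i′ j′ → mark marks i j i′ j′ ≡ true → X i′ j′ ≡ 0#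
        marked⇒0′ i′ j′ marked with mark-true marks marked
        ... | inj₁ marked′       = marked⇒0 i′ j′ marked′
        ... | inj₂ (refl , refl) = Xij≡0

      permutation⇒bounded : ∀ (σ : Permutation′ n) → (∀ i → OnlyOpen (marks i) (σ ⟨$⟩ʳ i)) → Bounded s
      permutation⇒bounded σ only = subst (_≤ t * m) (sym ⟨X,E⟩≡t*trσ) (*-monoˡ-≤ t 0≤t (trσ≤m σ))
        where
        entry : ∀ i j → Dec (σ ⟨$⟩ʳ i ≡ j) → X i j ≡ t * δ (σ ⟨$⟩ʳ i) j
        entry i j (yes refl) = trans (onlyOpen⇒t scaled marked⇒0 (only i))
                                     (sym (trans (cong (t *_) (δ-refl (σ ⟨$⟩ʳ i))) (*-identityʳ t)))
        entry i j (no σi≢j)  =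
          trans (marked⇒0 i j (¬-not λ Zij≡false → σi≢j (sym (proj₂ (only i) j Zij≡false))))
                (sym (trans (cong (t *_) (δ-≢ σi≢j)) (zeroʳ t)))
        ⟨X,E⟩≡t*trσ : ⟨ X , E ⟩ ≡ t * trσ σ E
        ⟨X,E⟩≡t*trσ = begin
          ⟨ X , E ⟩
            ≡⟨ ⟨⟩-cong E (λ i j → trans (entry i j (σ ⟨$⟩ʳ i ≟ j)) (cong (t *_) (sym (permMatrix-δ σ i j)))) ⟩
          ⟨ t ·ᴹ permMatrix σ , E ⟩
            ≡⟨ ⟨⟩-·ᴹ t (permMatrix σ) E ⟩
          t * ⟨ permMatrix σ , E ⟩
            ≡⟨ cong (t *_) (trσ≡⟨permMatrix⟩ σ E) ⟨
          t * trσ σ E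
            ∎
          where open ≡-Reasoning

      module CycleStep (cy : Cycle marks) (minus≤plus : weight (Cycle.minus cy) ≤ weight (Cycle.plus cy)) where
        open Cycle cy

        P N : Matrix n
        P = indicator plus
        N = indicator minus

        lightest : Σ (Fin length) λ k → ∀ l → uncurry X (minus k) ≤ uncurry X (minus l)
        lightest = argmin {{ℕ.>-nonZero length>0}} λ k → uncurry X (minus k)

        k* : Fin length
        k* = proj₁ lightest

        λ* : Carrier
        λ* = uncurry X (minus k*)

        X′ : Matrix n
        X′ = X +ᴹ λ* ·ᴹ P +ᴹ (- λ*) ·ᴹ N

        marks′ : Marks n
        marks′ = uncurry (mark marks) (minus k*)

        X′-entry : ∀ {i j v} → N i j ≡ v → X′ i j ≡ X i j + λ* * P i j + (- λ*) * v
        X′-entry {i} {j} = cong (λ v → X i j + λ* * P i j + (- λ*) * v)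

        0≤λ*P : ∀ i j → 0# ≤ λ* * P i j
        0≤λ*P i j = *-nonneg (nonneg _ _) (indicator-nonneg plus i j)

        open≢marked : ∀ {p i j} → uncurry marks p ≡ false → marks i j ≡ true → p ≢ (i , j)
        open≢marked open-p marked refl = case trans (sym open-p) marked of λ ()

        X′-nonneg : ∀ i j → 0# ≤ X′ i j
        X′-nonneg i j with any? (λ k → minus k ≟ₑ (i , j))
        ... | yes (l , refl) =
          subst (0# ≤_) (sym (trans (X′-entry (indicator-hit minus minus-injective l))
                                    (x+ay+[-a]1≡[x-a]+ay _ λ* _)))
                (+-nonneg (x≤y⇒0≤y-x (proj₂ lightest l)) (0≤λ*P i j))
        ... | no missed =
          subst (0# ≤_) (sym (trans (X′-entry (indicator-miss minus λ k minusk≡ij → missed (k , minusk≡ij)))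
                                    (trans (cong (X i j + λ* * P i j +_) (zeroʳ (- λ*))) (+-identityʳ _))))
                (+-nonneg (nonneg i j) (0≤λ*P i j))

        X′-lightest≡0 : uncurry X′ (minus k*) ≡ 0#
        X′-lightest≡0 = begin
          uncurry X′ (minus k*)
            ≡⟨ X′-entry (indicator-hit minus minus-injective k*) ⟩
          λ* + λ* * uncurry P (minus k*) + (- λ*) * 1#
            ≡⟨ x+ay+[-a]1≡[x-a]+ay λ* λ* _ ⟩
          (λ* - λ*) + λ* * uncurry P (minus k*)
            ≡⟨ cong₂ (λ u v → u + λ* * v) (-‿inverseʳ λ*) (indicator-miss plus λ k → plus≢minus k k*) ⟩
          0# + λ* * 0#
            ≡⟨ trans (+-identityˡ _) (zeroʳ λ*) ⟩
          0#
            ∎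
          where open ≡-Reasoning

        X′-marked⇒0 : ∀ i j → marks′ i j ≡ true → X′ i j ≡ 0#
        X′-marked⇒0 i j marked′ with mark-true marks marked′
        ... | inj₂ (refl , refl) = X′-lightest≡0
        ... | inj₁ marked        = begin
          X i j + λ* * P i j + (- λ*) * N i j
            ≡⟨ cong₂ (λ u v → X i j + λ* * u + (- λ*) * v)
                     (indicator-miss plus λ k → open≢marked (plus-open k) marked)
                     (indicator-miss minus λ k → open≢marked (minus-open k) marked) ⟩
          X i j + λ* * 0# + (- λ*) * 0#
            ≡⟨ x+ay+[-a]y≡x (X i j) λ* 0# ⟩
          X i j
            ≡⟨ marked⇒0 i j marked ⟩
          0#
            ∎
          where open ≡-Reasoning

        X′-scaled : IsScaledBistochastic t X′
        X′-scaled = record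
          { nonneg  = X′-nonneg
          ; rowSum≡ = λ i → begin
              rowSum X′ i
                ≡⟨ rowSum-+ᴹ·ᴹ (X +ᴹ λ* ·ᴹ P) (- λ*) N i ⟩
              rowSum (X +ᴹ λ* ·ᴹ P) i + (- λ*) * rowSum N i
                ≡⟨ cong (_+ (- λ*) * rowSum N i) (rowSum-+ᴹ·ᴹ X λ* P i) ⟩
              rowSum X i + λ* * rowSum P i + (- λ*) * rowSum N i
                ≡⟨ lineSum-preserved (rowSum-indicator plus i) (rows-balanced i) (rowSum-indicator minus i) ⟩
              rowSum X i
                ≡⟨ rowSum≡ i ⟩
              t
                ∎
          ; colSum≡ = λ j → begin
              colSum X′ j
                ≡⟨ rowSum-+ᴹ·ᴹ (transpose (X +ᴹ λ* ·ᴹ P)) (- λ*) (transpose N) j ⟩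
              colSum (X +ᴹ λ* ·ᴹ P) j + (- λ*) * colSum N j
                ≡⟨ cong (_+ (- λ*) * colSum N j) (rowSum-+ᴹ·ᴹ (transpose X) λ* (transpose P) j) ⟩
              colSum X j + λ* * colSum P j + (- λ*) * colSum N j
                ≡⟨ lineSum-preserved (colSum-indicator plus j) (cols-balanced j) (colSum-indicator minus j) ⟩
              colSum X j
                ≡⟨ colSum≡ j ⟩
              t
                ∎
          }
          where
          open ≡-Reasoning
          lineSum-preserved : ∀ {x p q a b} → p ≡ a → a ≡ b → q ≡ b → x + λ* * p + (- λ*) * q ≡ x
          lineSum-preserved {x} refl refl refl = x+ay+[-a]y≡x x λ* _

        ⟨X,E⟩≤⟨X′,E⟩ : ⟨ X , E ⟩ ≤ ⟨ X′ , E ⟩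
        ⟨X,E⟩≤⟨X′,E⟩ =
          subst (⟨ X , E ⟩ ≤_) (sym ⟨X′,E⟩≡) (x≤x+y ⟨ X , E ⟩ (0≤ay+[-a]z (nonneg _ _) minus≤plus))
          where
          ⟨X′,E⟩≡ : ⟨ X′ , E ⟩ ≡ ⟨ X , E ⟩ + (λ* * weight plus + (- λ*) * weight minus)
          ⟨X′,E⟩≡ = begin
            ⟨ X′ , E ⟩
              ≡⟨ ⟨⟩-+ᴹ·ᴹ (X +ᴹ λ* ·ᴹ P) (- λ*) N E ⟩
            ⟨ X +ᴹ λ* ·ᴹ P , E ⟩ + (- λ*) * ⟨ N , E ⟩
              ≡⟨ cong₂ (λ u v → u + (- λ*) * v) (⟨⟩-+ᴹ·ᴹ X λ* P E) (⟨indicator⟩ minus E) ⟩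
            ⟨ X , E ⟩ + λ* * ⟨ P , E ⟩ + (- λ*) * weight minus
              ≡⟨ cong (λ u → ⟨ X , E ⟩ + λ* * u + (- λ*) * weight minus) (⟨indicator⟩ plus E) ⟩
            ⟨ X , E ⟩ + λ* * weight plus + (- λ*) * weight minus
              ≡⟨ +-assoc ⟨ X , E ⟩ _ _ ⟩
            ⟨ X , E ⟩ + (λ* * weight plus + (- λ*) * weight minus)
              ∎
            where open ≡-Reasoning

        improvement : Improvement s
        improvement = record { X = X′ ; marks = marks′ ; scaled = X′-scaled ; marked⇒0 = X′-marked⇒0 }
                    , ⟨X,E⟩≤⟨X′,E⟩ , openCount-mark marks (minus-open k*)

      cycle⇒improvement : Cycle marks → Improvement s
      cycle⇒improvement cy with ≤-total (weight (Cycle.minus cy)) (weight (Cycle.plus cy))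
      ... | inj₁ minus≤plus = CycleStep.improvement cy minus≤plus
      ... | inj₂ plus≤minus = CycleStep.improvement (reverse cy) plus≤minus

      step : Bounded s ⊎ Improvement s
      step with closed-or-open marks | closed-or-open (flip marks)
      ... | inj₁ (_ , closedRow) | _ = inj₁ (t≡0⇒bounded (closed⇒t≡0 scaled marked⇒0 closedRow))
      ... | inj₂ _ | inj₁ (_ , closedCol) = inj₁ (t≡0⇒bounded (closed⇒t≡0 scaledᵀ marked⇒0ᵀ closedCol))
      ... | inj₂ rowsOpen | inj₂ colsOpen
          with shadowed-or-isolated marks | shadowed-or-isolated (flip marks)
      ...   | inj₁ (_ , _ , open′ , sh) | _ = inj₂ (markZero (shadowed⇒0 scaled marked⇒0 sh) open′)
      ...   | inj₂ _ | inj₁ (_ , _ , open′ , sh) = inj₂ (markZero (shadowed⇒0 scaledᵀ marked⇒0ᵀ sh) open′)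
      ...   | inj₂ isolated | inj₂ isolatedᵀ with several-or-singles marks rowsOpen
      ...     | inj₁ (_ , sev) =
        inj₂ (cycle⇒improvement (cycleFromWalk (alternatingWalk isolated isolatedᵀ sev)))
      ...     | inj₂ singles   =
        inj₁ (uncurry permutation⇒bounded (onlyOpenPermutation singles colsOpen isolated))

    bounded : ∀ s → Bounded s
    bounded = All.wfRec (On.wellFounded (λ s → openCount (State.marks s)) <-wellFounded) _ Bounded
      λ s rec → [ (λ bounded-s → bounded-s) , (λ { (s′ , ⟨⟩≤ , fewer) → ≤-trans ⟨⟩≤ (rec {s′} fewer) }) ]
                (step s)

    birkhoff-bound : ∀ {X} → IsScaledBistochastic t X → ⟨ X , E ⟩ ≤ t * m
    birkhoff-bound X-scaled =
      bounded (record { X = _ ; marks = λ _ _ → false ; scaled = X-scaled ; marked⇒0 = λ _ _ () })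

module ErdősMatrices {c ℓ} (F : OrderedField c ℓ) where
  open OrderedFieldProperties F
  open FiniteSums F
  open MatrixAlgebra F
  open Matrices F
  open MaxtraceBound F using (birkhoff-bound)

  private variable
    n : ℕ

  IsMaxtrace-unique : ∀ {M : Matrix n} {a b} → IsMaxtrace a M → IsMaxtrace b M → a ≡ b
  IsMaxtrace-unique ((σ , trσ≡a) , ≤a) ((τ , trτ≡b) , ≤b) =
    ≤-antisym (subst (_≤ _) trσ≡a (≤b σ)) (subst (_≤ _) trτ≡b (≤a τ))

  subtract-permMatrix-scaled : ∀ {E : Matrix n} {ε} (σ : Permutation′ n) →
                               IsScaledBistochastic 1# E → (∀ i → ε ≤ E i (σ ⟨$⟩ʳ i)) →
                               IsScaledBistochastic (1# - ε) (E +ᴹ (- ε) ·ᴹ permMatrix σ)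
  subtract-permMatrix-scaled {E = E} {ε} σ E-scaled ε≤E = record
    { nonneg  = λ i j → subst (0# ≤_) (cong (λ v → E i j + (- ε) * v) (sym (permMatrix-δ σ i j)))
                                      (nonneg′ i j (σ ⟨$⟩ʳ i ≟ j))
    ; rowSum≡ = λ i → trans (rowSum-+ᴹ·ᴹ E (- ε) (permMatrix σ) i) (lineSum (rowSum≡ i) (P.rowSum≡ i))
    ; colSum≡ = λ j → trans (rowSum-+ᴹ·ᴹ (transpose E) (- ε) (transpose (permMatrix σ)) j)
                            (lineSum (colSum≡ j) (P.colSum≡ j))
    }
    where
    open IsScaledBistochastic E-scaled
    module P = IsScaledBistochastic (permMatrix-scaled σ)
    lineSum : ∀ {u v} → u ≡ 1# → v ≡ 1# → u + (- ε) * v ≡ 1# - ε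
    lineSum refl refl = cong (1# +_) (*-identityʳ (- ε))
    nonneg′ : ∀ i j → Dec (σ ⟨$⟩ʳ i ≡ j) → 0# ≤ E i j + (- ε) * δ (σ ⟨$⟩ʳ i) j
    nonneg′ i j (yes refl) =
      subst (0# ≤_) (sym (cong (E i j +_) (trans (cong ((- ε) *_) (δ-refl j)) (*-identityʳ (- ε)))))
            (x≤y⇒0≤y-x (ε≤E i))
    nonneg′ i j (no σi≢j) =
      subst (0# ≤_) (sym (trans (cong (λ v → E i j + (- ε) * v) (δ-≢ σi≢j))
                                (trans (cong (E i j +_) (zeroʳ (- ε))) (+-identityʳ (E i j)))))
            (nonneg i j)

  sumSq≤trσ-on-support : ∀ {E : Matrix n} → Bistochastic E → (∀ σ → trσ σ E ≤ sumSq E) →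
                         ∀ σ → σ ∈P[ E ] → sumSq E ≤ trσ σ E
  sumSq≤trσ-on-support {zero}  _ _ _ _ = ≤-refl 0#
  sumSq≤trσ-on-support {suc n} {E} E-bistochastic trσ≤sumSq σ σ∈P =
    x+[-ε]y≤[1-ε]x⇒x≤y 0≤ε ε≢0
      (subst (_≤ (1# - ε) * sumSq E) ⟨X,E⟩≡ (birkhoff-bound E trσ≤sumSq 0≤1-ε X-scaled))
    where
    lightest : Σ (Fin (suc n)) λ i → ∀ j → E i (σ ⟨$⟩ʳ i) ≤ E j (σ ⟨$⟩ʳ j)
    lightest = argmin λ i → E i (σ ⟨$⟩ʳ i)
    ε : Carrier
    ε = E (proj₁ lightest) (σ ⟨$⟩ʳ proj₁ lightest)
    ε-bounds : 0# ≤ ε × ε ≤ 1#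
    ε-bounds = proj₁ E-bistochastic (proj₁ lightest) _
    0≤ε : 0# ≤ ε
    0≤ε = proj₁ ε-bounds
    0≤1-ε : 0# ≤ 1# - ε
    0≤1-ε = x≤y⇒0≤y-x (proj₂ ε-bounds)
    ε≢0 : ε ≢ 0#
    ε≢0 = σ∈P (proj₁ lightest) _ (trans (permMatrix-δ σ _ _) (δ-refl (σ ⟨$⟩ʳ proj₁ lightest)))
    X-scaled : IsScaledBistochastic (1# - ε) (E +ᴹ (- ε) ·ᴹ permMatrix σ)
    X-scaled = subtract-permMatrix-scaled σ (bistochastic-scaled E-bistochastic) (proj₂ lightest)
    ⟨X,E⟩≡ : ⟨ E +ᴹ (- ε) ·ᴹ permMatrix σ , E ⟩ ≡ sumSq E + (- ε) * trσ σ E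
    ⟨X,E⟩≡ = trans (⟨⟩-+ᴹ·ᴹ E (- ε) (permMatrix σ) E)
                   (cong (λ v → sumSq E + (- ε) * v) (sym (trσ≡⟨permMatrix⟩ σ E)))

proposition2p7 : ∀ {c ℓ : Level} (F : OrderedField c ℓ) (n : ℕ)
                 (E : Matrices.Matrix F n) → Matrices.Erdős F E →
                 (σ₀ : Permutation′ n) → Matrices._∈P[_] F σ₀ E →
                 (m : OrderedField.Carrier F) → Matrices.IsMaxtrace F m E →
                 Matrices.trσ F σ₀ E ≡ m
proposition2p7 F n E (E-bistochastic , sumSq-maxtrace) σ₀ σ₀∈P m m-maxtrace =
  ≤-antisym (proj₂ m-maxtrace σ₀) (subst (_≤ trσ σ₀ E) sumSq≡m sumSq≤trσ₀)
  where
  open OrderedField F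
  open Matrices F
  open ErdősMatrices F
  sumSq≡m : sumSq E ≡ m
  sumSq≡m = IsMaxtrace-unique sumSq-maxtrace m-maxtrace
  sumSq≤trσ₀ : sumSq E ≤ trσ σ₀ E
  sumSq≤trσ₀ = sumSq≤trσ-on-support E-bistochastic (proj₂ sumSq-maxtrace) σ₀ σ₀∈P
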